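{- Let $f\in\mathbb{F}_q[t]$ be written as $f=a_{i_0}+a_{i_1}t+\dots+a_{i_n}t^n$ with $0\le i_j\le q-1$ and $a_{i_n}\ne0$. Then $$f!=\Big(\prod_{j=0}^{n}a_{i_j}!\Big)\prod_{j=1}^{n}\ \prod_{\substack{h\in\mathbb{F}_q[t],\ \deg h=j\\ h \text{ monic}}}h^{i_j}.$$
   Context: Let $\mathbb{F}_q$ be a finite field with $q$ elements ($q$ a prime power). Fix an enumeration $\mathbb{F}_q=\{a_0,a_1,\dots,a_{q-1}\}$ with $a_0=0$, $a_1=1$. Every nonzero $f\in\mathbb{F}_q[t]$ of degree $m$ is uniquely written $f=a_{i_0}+a_{i_1}t+\dots+a_{i_m}t^m$ with $0\le i_j\le q-1$, $a_{i_m}\neq 0$. Put $\delta(f)=i_0+i_1q+\dots+i_mq^m$ and $\delta(0)=0$. Order $\mathbb{F}_q[t]$ by: $f>g$ iff $\delta(f)>\delta(g)$. For nonzero $f$, the factorial is $f!=\prod_{g<f}(f-g)$ (product over all $g\in\mathbb{F}_q[t]$ with $g<f$), and $0!=1$; this applies in particular to constants $a_{i}\in\mathbb{F}_q\subset\mathbb{F}_q[t]$. -}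

module Defs where

open import Data.Nat using (ℕ; zero; suc; _+_; _*_; _<?_)
open import Data.Fin using (Fin; toℕ; _≟_)
open import Data.List using (List; []; _∷_; _++_; map; foldr; filter; length; drop; concatMap; allFin)
open import Data.Product using (∃)
open import Data.Bool using (if_then_else_)
open import Relation.Nullary using (¬_)
open import Relation.Nullary.Decidable using (⌊_⌋)
open import Relation.Binary.PropositionalEquality using (_≡_; _≢_)
open import Algebra.Core using (Op₁; Op₂)
open import Algebra.Structures using (IsCommutativeRing)

-- A finite field F_q together with an enumeration F_q = {a_0, ..., a_{q-1}}:
-- the carrier is Fin q, and the element i : Fin q plays the role of a_{toℕ i}.
-- The enumeration conditions a_0 = 0, a_1 = 1 are  toℕ 0F ≡ 0,  toℕ 1F ≡ 1.
record FiniteField (q : ℕ) : Set where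
  field
    _+F_ : Op₂ (Fin q)
    _*F_ : Op₂ (Fin q)
    -F_  : Op₁ (Fin q)
    0F   : Fin q
    1F   : Fin q
    isCommutativeRing : IsCommutativeRing _≡_ _+F_ _*F_ -F_ 0F 1F
    0≢1     : 0F ≢ 1F
    inverse : ∀ x → x ≢ 0F → ∃ λ y → x *F y ≡ 1F
    toℕ-0F  : toℕ 0F ≡ 0
    toℕ-1F  : toℕ 1F ≡ 1

-- Polynomials in F_q[t] as coefficient lists (constant term first).
-- Two coefficient lists denote the same polynomial iff their normalizations
-- (trailing zeros removed) are equal.
module Poly {q : ℕ} (F : FiniteField q) where
  open FiniteField F

  Pol : Set
  Pol = List (Fin q)

  consN : Fin q → Pol → Pol
  consN a [] = if ⌊ a ≟ 0F ⌋ then [] else (a ∷ [])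
  consN a (b ∷ r) = a ∷ b ∷ r

  normalize : Pol → Pol
  normalize = foldr consN []

  addP : Pol → Pol → Pol
  addP [] r = r
  addP (a ∷ p) [] = a ∷ p
  addP (a ∷ p) (b ∷ r) = (a +F b) ∷ addP p r

  negP : Pol → Pol
  negP = map -F_

  subP : Pol → Pol → Pol
  subP p r = addP p (negP r)

  mulP : Pol → Pol → Pol
  mulP [] r = []
  mulP (a ∷ p) r = addP (map (a *F_) r) (0F ∷ mulP p r)

  oneP : Pol
  oneP = 1F ∷ []

  powP : Pol → ℕ → Pol
  powP p zero = oneP
  powP p (suc k) = mulP p (powP p k)

  prodP : List Pol → Pol
  prodP = foldr mulP oneP

  -- δ(a_{i_0} + ... + a_{i_m} t^m) = i_0 + i_1 q + ... + i_m q^m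
  -- (trailing zero coefficients contribute 0 since a_0 = 0 has index 0).
  δ : Pol → ℕ
  δ [] = 0
  δ (a ∷ p) = toℕ a + q * δ p

  allLists : ℕ → List Pol
  allLists zero = [] ∷ []
  allLists (suc n) = concatMap (λ a → map (a ∷_) (allLists n)) (allFin q)

  -- f! = ∏_{g < f} (f - g); every g with δ g < δ f has degree ≤ deg f,
  -- so it occurs exactly once (zero-padded) among the lists of length (length f).
  -- For f = 0 the product is empty, i.e. 0! = 1.
  fact : Pol → Pol
  fact f = prodP (map (λ g → subP f g) (filter (λ g → δ g <? δ f) (allLists (length f))))

  monicPow : ℕ → ℕ → Pol
  monicPow j k = prodP (map (λ v → powP (v ++ (1F ∷ [])) k) (allLists j))

  tailProd : ℕ → Pol → Pol
  tailProd j [] = oneP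
  tailProd j (a ∷ as) = mulP (monicPow j (toℕ a)) (tailProd (suc j) as)

  rhs : Pol → Pol
  rhs f = mulP (prodP (map (λ a → fact (a ∷ [])) f)) (tailProd 1 (drop 1 f))

module Submission where

-- Write f = cs + c·tⁿ with deg cs < n. A polynomial g = gs + b·tⁿ of degree ≤ n lies below f
-- exactly when a_b < a_c, or b = c and gs < cs. In the first case f − g runs over all
-- polynomials of degree n with leading coefficient c − b, which are (c − b)·h for h monic, so
-- they contribute (c − b)^(qⁿ) · ∏_{deg h = n} h = (c − b) · ∏_{deg h = n} h by Fermat; the
-- second case contributes cs!. Hence f! = c! · (∏_{deg h = n} h)^(i_n) · cs!, and the formula
-- follows by induction on n.

open import Defs
open import Data.Nat using (ℕ; zero; suc)
import Data.Nat as ℕ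
import Data.Nat.Properties as ℕ
open import Data.Fin using (Fin; zero; suc; toℕ; _≟_)
import Data.Fin.Properties as Fin
open import Data.Fin.Permutation using (Permutation′; permutation; _⟨$⟩ʳ_)
open import Data.List
  using (List; []; _∷_; _++_; [_]; _∷ʳ_; foldr; map; concatMap; filter; length; drop; allFin)
open import Data.List.Properties using (map-∘; map-tabulate; map-++; length-++-comm)
open import Data.List.Relation.Unary.All as All using (All; []; _∷_)
import Data.List.Relation.Unary.All.Properties as All
open import Data.List.Reverse using (Reverse; []; _∶_∶ʳ_; reverseView)
open import Data.Bool using (if_then_else_; true; false)
open import Data.Product using (_,_; proj₁; proj₂)
open import Data.Empty using (⊥-elim)
open import Function.Base using (_∘_; id)
open import Function.Bundles using (_⇔_; mk⇔)
open import Relation.Nullary using (does; yes; no)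
open import Relation.Nullary.Decidable using (dec-true; dec-false; does-⇔)
open import Relation.Unary using (Decidable)
open import Relation.Binary.Definitions using (tri<; tri≈; tri>)
open import Relation.Binary.PropositionalEquality
  using (_≡_; _≢_; refl; sym; trans; cong; cong₂; subst; subst₂; module ≡-Reasoning)
open import Algebra.Bundles using (CommutativeMonoid; AbelianGroup)
open import Algebra.Structures using (IsCommutativeRing)

module BigProduct {c ℓ} (M : CommutativeMonoid c ℓ) where
  open CommutativeMonoid M renaming (refl to ≈-refl; sym to ≈-sym; trans to ≈-trans; reflexive to ≈-reflexive)
  open import Algebra.Properties.CommutativeMonoid.Sum M using (sum; sum-permute)
  open import Algebra.Properties.CommutativeSemigroup commutativeSemigroup using (interchange)

  private variable
    A B : Set

  ∏ : List A → (A → Carrier) → Carrier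
  ∏ xs G = foldr _∙_ ε (map G xs)

  infixr 8 _^_
  _^_ : Carrier → ℕ → Carrier
  x ^ zero  = ε
  x ^ suc k = x ∙ x ^ k

  ∏-cong-All : {G H : A → Carrier} {xs : List A} → All (λ x → G x ≈ H x) xs → ∏ xs G ≈ ∏ xs H
  ∏-cong-All []       = ≈-refl
  ∏-cong-All (e ∷ es) = ∙-cong e (∏-cong-All es)

  ∏-cong : {G H : A → Carrier} (xs : List A) → (∀ x → G x ≈ H x) → ∏ xs G ≈ ∏ xs H
  ∏-cong xs e = ∏-cong-All (All.universal e xs)

  ∏-++ : (G : A → Carrier) (xs ys : List A) → ∏ (xs ++ ys) G ≈ ∏ xs G ∙ ∏ ys G
  ∏-++ G []       ys = ≈-sym (identityˡ _)
  ∏-++ G (x ∷ xs) ys = ≈-trans (∙-congˡ (∏-++ G xs ys)) (≈-sym (assoc _ _ _))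

  ∏-map : (G : B → Carrier) (f : A → B) (xs : List A) → ∏ (map f xs) G ≡ ∏ xs (G ∘ f)
  ∏-map G f xs = cong (foldr _∙_ ε) (sym (map-∘ xs))

  ∏-concatMap : (G : B → Carrier) (h : A → List B) (xs : List A) →
                ∏ (concatMap h xs) G ≈ ∏ xs (λ a → ∏ (h a) G)
  ∏-concatMap G h []       = ≈-refl
  ∏-concatMap G h (x ∷ xs) = ≈-trans (∏-++ G (h x) (concatMap h xs)) (∙-congˡ (∏-concatMap G h xs))

  ∏-ε : (xs : List A) → ∏ xs (λ _ → ε) ≈ ε
  ∏-ε []       = ≈-refl
  ∏-ε (x ∷ xs) = ≈-trans (∙-congˡ (∏-ε xs)) (identityˡ ε)

  ∏-distrib : (G H : A → Carrier) (xs : List A) → ∏ xs (λ x → G x ∙ H x) ≈ ∏ xs G ∙ ∏ xs H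
  ∏-distrib G H []       = ≈-sym (identityˡ ε)
  ∏-distrib G H (x ∷ xs) = ≈-trans (∙-congˡ (∏-distrib G H xs)) (interchange _ _ _ _)

  ∏-comm : (X : A → B → Carrier) (xs : List A) (ys : List B) →
           ∏ xs (λ a → ∏ ys (X a)) ≈ ∏ ys (λ b → ∏ xs (λ a → X a b))
  ∏-comm X []       ys = ≈-sym (∏-ε ys)
  ∏-comm X (x ∷ xs) ys =
    ≈-trans (∙-congˡ (∏-comm X xs ys)) (≈-sym (∏-distrib (X x) (λ b → ∏ xs (λ a → X a b)) ys))

  ∏-^ : (G : A → Carrier) (xs : List A) (k : ℕ) → ∏ xs (λ x → G x ^ k) ≈ ∏ xs G ^ k
  ∏-^ G xs zero    = ∏-ε xs
  ∏-^ G xs (suc k) = ≈-trans (∏-distrib G (λ x → G x ^ k) xs) (∙-congˡ (∏-^ G xs k))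

  ∏-filter : {P : A → Set} (P? : Decidable P) (G : A → Carrier) (xs : List A) →
             ∏ (filter P? xs) G ≈ ∏ xs (λ x → if does (P? x) then G x else ε)
  ∏-filter P? G []       = ≈-refl
  ∏-filter P? G (x ∷ xs) with P? x
  ... | yes _ = ∙-congˡ (∏-filter P? G xs)
  ... | no  _ = ≈-trans (∏-filter P? G xs) (≈-sym (identityˡ _))

  ∏-allFin-suc : ∀ n (G : Fin (suc n) → Carrier) →
                 ∏ (allFin (suc n)) G ≡ G zero ∙ ∏ (allFin n) (G ∘ suc)
  ∏-allFin-suc n G =
    cong (λ xs → G zero ∙ foldr _∙_ ε xs) (trans (map-tabulate suc G) (sym (map-tabulate id (G ∘ suc))))

  ∏-allFin≡sum : ∀ {n} (G : Fin n → Carrier) → ∏ (allFin n) G ≡ sum G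
  ∏-allFin≡sum {zero}  G = refl
  ∏-allFin≡sum {suc n} G = trans (∏-allFin-suc n G) (cong (G zero ∙_) (∏-allFin≡sum (G ∘ suc)))

  ∏-allFin-permute : ∀ {n} (π : Permutation′ n) (G : Fin n → Carrier) →
                     ∏ (allFin n) (λ x → G (π ⟨$⟩ʳ x)) ≈ ∏ (allFin n) G
  ∏-allFin-permute π G = ≈-trans (≈-reflexive (∏-allFin≡sum (λ x → G (π ⟨$⟩ʳ x))))
    (≈-trans (≈-sym (sum-permute G π)) (≈-reflexive (sym (∏-allFin≡sum G))))

  -- Both lemmas rely on  does (suc x ≟ suc y)  and  does (suc m <? suc n)  reducing to
  -- does (x ≟ y)  and  does (m <? n).
  ∏-allFin-indicator : ∀ {n} (z : Fin n) (Y : Carrier) →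
                       ∏ (allFin n) (λ b → if does (b ≟ z) then Y else ε) ≈ Y
  ∏-allFin-indicator {suc n} zero Y =
    ≈-trans (≈-reflexive (∏-allFin-suc n _)) (≈-trans (∙-congˡ (∏-ε (allFin n))) (identityʳ Y))
  ∏-allFin-indicator {suc n} (suc z) Y =
    ≈-trans (≈-reflexive (∏-allFin-suc n _)) (≈-trans (identityˡ _) (∏-allFin-indicator z Y))

  ∏-allFin-below : ∀ {n} (c : Fin n) (X : Carrier) →
                   ∏ (allFin n) (λ b → if does (toℕ b ℕ.<? toℕ c) then X else ε) ≈ X ^ toℕ c
  ∏-allFin-below {suc n} zero X =
    ≈-trans (≈-reflexive (∏-allFin-suc n _)) (≈-trans (identityˡ _) (∏-ε (allFin n)))
  ∏-allFin-below {suc n} (suc c) X =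
    ≈-trans (≈-reflexive (∏-allFin-suc n _)) (∙-congˡ (∏-allFin-below c X))

module _ {q : ℕ} (F : FiniteField q) where
  open FiniteField F
  open IsCommutativeRing isCommutativeRing
    using ( +-assoc; +-identityˡ; +-identityʳ; -‿inverseʳ; *-assoc; *-comm
          ; *-identityˡ; *-identityʳ; zeroˡ; zeroʳ; distribˡ; distribʳ
          ; +-isAbelianGroup; +-isCommutativeMonoid; *-isCommutativeMonoid )
  open Poly F
  open import Data.Nat using (_+_; _*_; _<_; _<?_)

  -- Coefficientwise equality and the multiplicative monoid of polynomials

  coeff : ℕ → Pol → Fin q
  coeff k       []      = 0F
  coeff zero    (a ∷ p) = a
  coeff (suc k) (a ∷ p) = coeff k p

  infix 4 _≈_
  record _≈_ (p r : Pol) : Set where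
    constructor coeffwise
    field coeff-≡ : ∀ k → coeff k p ≡ coeff k r
  open _≈_

  ≈-refl : ∀ {p} → p ≈ p
  ≈-refl = coeffwise λ k → refl

  ≈-sym : ∀ {p r} → p ≈ r → r ≈ p
  ≈-sym e = coeffwise λ k → sym (coeff-≡ e k)

  ≈-trans : ∀ {p r s} → p ≈ r → r ≈ s → p ≈ s
  ≈-trans e e′ = coeffwise λ k → trans (coeff-≡ e k) (coeff-≡ e′ k)

  ≈-reflexive : ∀ {p r} → p ≡ r → p ≈ r
  ≈-reflexive refl = ≈-refl

  ∷-cong : ∀ {a b p r} → a ≡ b → p ≈ r → (a ∷ p) ≈ (b ∷ r)
  ∷-cong e e′ = coeffwise λ { zero → e ; (suc k) → coeff-≡ e′ k }

  ∷-injectiveʳ : ∀ {a b p r} → (a ∷ p) ≈ (b ∷ r) → p ≈ r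
  ∷-injectiveʳ e = coeffwise λ k → coeff-≡ e (suc k)

  [0]≈[] : (0F ∷ []) ≈ []
  [0]≈[] = coeffwise λ { zero → refl ; (suc k) → refl }

  ∷ʳ0≈ : ∀ p → (p ∷ʳ 0F) ≈ p
  ∷ʳ0≈ []      = [0]≈[]
  ∷ʳ0≈ (a ∷ p) = ∷-cong refl (∷ʳ0≈ p)

  normalize-[] : ∀ p → [] ≈ p → normalize p ≡ []
  normalize-[] []      e = refl
  normalize-[] (a ∷ p) e rewrite normalize-[] p (coeffwise λ k → coeff-≡ e (suc k)) with a ≟ 0F
  ... | yes _   = refl
  ... | no  a≢0 = ⊥-elim (a≢0 (sym (coeff-≡ e zero)))

  normalize-cong : ∀ {p r} → p ≈ r → normalize p ≡ normalize r
  normalize-cong {[]}    {r}     e = sym (normalize-[] r e)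
  normalize-cong {a ∷ p} {[]}    e = normalize-[] (a ∷ p) (≈-sym e)
  normalize-cong {a ∷ p} {b ∷ r} e = cong₂ consN (coeff-≡ e zero) (normalize-cong (∷-injectiveʳ e))

  scale : Fin q → Pol → Pol
  scale a = map (a *F_)

  coeff-addP : ∀ p r k → coeff k (addP p r) ≡ coeff k p +F coeff k r
  coeff-addP []      r       k       = sym (+-identityˡ _)
  coeff-addP (a ∷ p) []      k       = sym (+-identityʳ _)
  coeff-addP (a ∷ p) (b ∷ r) zero    = refl
  coeff-addP (a ∷ p) (b ∷ r) (suc k) = coeff-addP p r k

  coeff-scale : ∀ a p k → coeff k (scale a p) ≡ a *F coeff k p
  coeff-scale a []      k       = sym (zeroʳ a)
  coeff-scale a (b ∷ p) zero    = refl
  coeff-scale a (b ∷ p) (suc k) = coeff-scale a p k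

  addP-cong : ∀ {p p′ r r′} → p ≈ p′ → r ≈ r′ → addP p r ≈ addP p′ r′
  addP-cong {p} {p′} {r} {r′} e e′ = coeffwise λ k →
    trans (coeff-addP p r k) (trans (cong₂ _+F_ (coeff-≡ e k) (coeff-≡ e′ k)) (sym (coeff-addP p′ r′ k)))

  scale-cong : ∀ {a b p r} → a ≡ b → p ≈ r → scale a p ≈ scale b r
  scale-cong {a} {b} {p} {r} e e′ = coeffwise λ k →
    trans (coeff-scale a p k) (trans (cong₂ _*F_ e (coeff-≡ e′ k)) (sym (coeff-scale b r k)))

  +-commutativeMonoid : CommutativeMonoid _ _
  +-commutativeMonoid = record { isCommutativeMonoid = +-isCommutativeMonoid }

  *-commutativeMonoid : CommutativeMonoid _ _
  *-commutativeMonoid = record { isCommutativeMonoid = *-isCommutativeMonoid }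

  open import Algebra.Properties.CommutativeSemigroup
    (CommutativeMonoid.commutativeSemigroup +-commutativeMonoid)
    using () renaming (x∙yz≈y∙xz to +-x∙yz≈y∙xz; interchange to +-interchange)

  addP-swap : ∀ x y z → addP x (addP y z) ≈ addP y (addP x z)
  addP-swap x y z = coeffwise λ k → begin
      coeff k (addP x (addP y z))            ≡⟨ coeff-addP-addP x y z k ⟩
      coeff k x +F (coeff k y +F coeff k z)  ≡⟨ +-x∙yz≈y∙xz _ _ _ ⟩
      coeff k y +F (coeff k x +F coeff k z)  ≡⟨ sym (coeff-addP-addP y x z k) ⟩
      coeff k (addP y (addP x z))            ∎
    where
      open ≡-Reasoning
      coeff-addP-addP : ∀ x y z k → coeff k (addP x (addP y z)) ≡ coeff k x +F (coeff k y +F coeff k z)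
      coeff-addP-addP x y z k = trans (coeff-addP x _ k) (cong (coeff k x +F_) (coeff-addP y z k))

  addP-interchange : ∀ a b c d → addP (addP a b) (addP c d) ≈ addP (addP a c) (addP b d)
  addP-interchange a b c d = coeffwise λ k → begin
      coeff k (addP (addP a b) (addP c d))                  ≡⟨ coeff-addP-pair a b c d k ⟩
      (coeff k a +F coeff k b) +F (coeff k c +F coeff k d)  ≡⟨ +-interchange _ _ _ _ ⟩
      (coeff k a +F coeff k c) +F (coeff k b +F coeff k d)  ≡⟨ sym (coeff-addP-pair a c b d k) ⟩
      coeff k (addP (addP a c) (addP b d))                  ∎
    where
      open ≡-Reasoning
      coeff-addP-pair : ∀ a b c d k → coeff k (addP (addP a b) (addP c d))
                                      ≡ (coeff k a +F coeff k b) +F (coeff k c +F coeff k d)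
      coeff-addP-pair a b c d k =
        trans (coeff-addP (addP a b) _ k) (cong₂ _+F_ (coeff-addP a b k) (coeff-addP c d k))

  addP-identityʳ : ∀ x → addP x [] ≈ x
  addP-identityʳ x = coeffwise λ k → trans (coeff-addP x [] k) (+-identityʳ _)

  scale-distribʳ : ∀ a b r → scale (a +F b) r ≈ addP (scale a r) (scale b r)
  scale-distribʳ a b r = coeffwise λ k → begin
      coeff k (scale (a +F b) r)                  ≡⟨ coeff-scale (a +F b) r k ⟩
      (a +F b) *F coeff k r                       ≡⟨ distribʳ _ a b ⟩
      (a *F coeff k r) +F (b *F coeff k r)
        ≡⟨ sym (cong₂ _+F_ (coeff-scale a r k) (coeff-scale b r k)) ⟩
      coeff k (scale a r) +F coeff k (scale b r)  ≡⟨ sym (coeff-addP (scale a r) _ k) ⟩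
      coeff k (addP (scale a r) (scale b r))      ∎
    where open ≡-Reasoning

  scale-distribˡ : ∀ a x y → scale a (addP x y) ≈ addP (scale a x) (scale a y)
  scale-distribˡ a x y = coeffwise λ k → begin
      coeff k (scale a (addP x y))                ≡⟨ coeff-scale a (addP x y) k ⟩
      a *F coeff k (addP x y)                     ≡⟨ cong (a *F_) (coeff-addP x y k) ⟩
      a *F (coeff k x +F coeff k y)               ≡⟨ distribˡ a _ _ ⟩
      (a *F coeff k x) +F (a *F coeff k y)
        ≡⟨ sym (cong₂ _+F_ (coeff-scale a x k) (coeff-scale a y k)) ⟩
      coeff k (scale a x) +F coeff k (scale a y)  ≡⟨ sym (coeff-addP (scale a x) _ k) ⟩
      coeff k (addP (scale a x) (scale a y))      ∎
    where open ≡-Reasoning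

  scale-scale : ∀ a b r → scale a (scale b r) ≈ scale (a *F b) r
  scale-scale a b r = coeffwise λ k → begin
      coeff k (scale a (scale b r))  ≡⟨ coeff-scale a (scale b r) k ⟩
      a *F coeff k (scale b r)       ≡⟨ cong (a *F_) (coeff-scale b r k) ⟩
      a *F (b *F coeff k r)          ≡⟨ sym (*-assoc a b _) ⟩
      (a *F b) *F coeff k r          ≡⟨ sym (coeff-scale (a *F b) r k) ⟩
      coeff k (scale (a *F b) r)     ∎
    where open ≡-Reasoning

  scale-zero : ∀ r → scale 0F r ≈ []
  scale-zero r = coeffwise λ k → trans (coeff-scale 0F r k) (zeroˡ _)

  scale-one : ∀ r → scale 1F r ≈ r
  scale-one r = coeffwise λ k → trans (coeff-scale 1F r k) (*-identityˡ _)

  mulP-zeroˡ : ∀ p r → p ≈ [] → mulP p r ≈ []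
  mulP-zeroˡ []      r e = ≈-refl
  mulP-zeroˡ (b ∷ p) r e =
    addP-cong (≈-trans (scale-cong (coeff-≡ e zero) ≈-refl) (scale-zero r))
              (≈-trans (∷-cong refl (mulP-zeroˡ p r (coeffwise λ k → coeff-≡ e (suc k)))) [0]≈[])

  mulP-zeroʳ : ∀ p → mulP p [] ≈ []
  mulP-zeroʳ []      = ≈-refl
  mulP-zeroʳ (a ∷ p) = ≈-trans (∷-cong refl (mulP-zeroʳ p)) [0]≈[]

  mulP-congˡ : ∀ {p p′} r → p ≈ p′ → mulP p r ≈ mulP p′ r
  mulP-congˡ {[]}    {p′}     r e = ≈-sym (mulP-zeroˡ p′ r (≈-sym e))
  mulP-congˡ {a ∷ p} {[]}     r e = mulP-zeroˡ (a ∷ p) r e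
  mulP-congˡ {a ∷ p} {b ∷ p′} r e =
    addP-cong (scale-cong (coeff-≡ e zero) ≈-refl) (∷-cong refl (mulP-congˡ r (∷-injectiveʳ e)))

  mulP-congʳ : ∀ p {r r′} → r ≈ r′ → mulP p r ≈ mulP p r′
  mulP-congʳ []      e = ≈-refl
  mulP-congʳ (a ∷ p) e = addP-cong (scale-cong refl e) (∷-cong refl (mulP-congʳ p e))

  mulP-cong : ∀ {x y u v} → x ≈ y → u ≈ v → mulP x u ≈ mulP y v
  mulP-cong {x} {y} {u} e e′ = ≈-trans (mulP-congˡ u e) (mulP-congʳ y e′)

  mulP-consʳ : ∀ r a p → mulP r (a ∷ p) ≈ addP (scale a r) (0F ∷ mulP r p)
  mulP-consʳ []      a p = ≈-sym [0]≈[]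
  mulP-consʳ (b ∷ r) a p =
    ∷-cong (cong (_+F 0F) (*-comm b a))
      (≈-trans (addP-cong ≈-refl (mulP-consʳ r a p)) (addP-swap (scale b p) (scale a r) (0F ∷ mulP r p)))

  mulP-comm : ∀ p r → mulP p r ≈ mulP r p
  mulP-comm []      r = ≈-sym (mulP-zeroʳ r)
  mulP-comm (a ∷ p) r = ≈-trans (addP-cong ≈-refl (∷-cong refl (mulP-comm p r))) (≈-sym (mulP-consʳ r a p))

  mulP-identityˡ : ∀ r → mulP oneP r ≈ r
  mulP-identityˡ r = ≈-trans (addP-cong (scale-one r) [0]≈[]) (addP-identityʳ r)

  mulP-identityʳ : ∀ r → mulP r oneP ≈ r
  mulP-identityʳ r = ≈-trans (mulP-comm r oneP) (mulP-identityˡ r)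

  mulP-distribʳ : ∀ p p′ r → mulP (addP p p′) r ≈ addP (mulP p r) (mulP p′ r)
  mulP-distribʳ []      p′       r = ≈-refl
  mulP-distribʳ (a ∷ p) []       r = ≈-sym (addP-identityʳ _)
  mulP-distribʳ (a ∷ p) (b ∷ p′) r =
    ≈-trans (addP-cong (scale-distribʳ a b r) (∷-cong (sym (+-identityˡ 0F)) (mulP-distribʳ p p′ r)))
      (addP-interchange (scale a r) (scale b r) (0F ∷ mulP p r) (0F ∷ mulP p′ r))

  mulP-scaleˡ : ∀ a p r → mulP (scale a p) r ≈ scale a (mulP p r)
  mulP-scaleˡ a []      r = ≈-refl
  mulP-scaleˡ a (b ∷ p) r =
    ≈-trans (addP-cong (≈-sym (scale-scale a b r)) (∷-cong (sym (zeroʳ a)) (mulP-scaleˡ a p r)))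
      (≈-sym (scale-distribˡ a (scale b r) (0F ∷ mulP p r)))

  mulP-shiftˡ : ∀ p r → mulP (0F ∷ p) r ≈ (0F ∷ mulP p r)
  mulP-shiftˡ p r = addP-cong (scale-zero r) ≈-refl

  mulP-assoc : ∀ p r s → mulP (mulP p r) s ≈ mulP p (mulP r s)
  mulP-assoc []      r s = ≈-refl
  mulP-assoc (a ∷ p) r s =
    ≈-trans (mulP-distribʳ (scale a r) (0F ∷ mulP p r) s)
      (addP-cong (mulP-scaleˡ a r s) (≈-trans (mulP-shiftˡ (mulP p r) s) (∷-cong refl (mulP-assoc p r s))))

  mulP-commutativeMonoid : CommutativeMonoid _ _
  mulP-commutativeMonoid = record
    { Carrier = Pol ; _≈_ = _≈_ ; _∙_ = mulP ; ε = oneP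
    ; isCommutativeMonoid = record
      { isMonoid = record
        { isSemigroup = record
          { isMagma = record
            { isEquivalence = record { refl = ≈-refl ; sym = ≈-sym ; trans = ≈-trans }
            ; ∙-cong = mulP-cong }
          ; assoc = mulP-assoc }
        ; identity = mulP-identityˡ , mulP-identityʳ }
      ; comm = mulP-comm } }

  module 𝔽 = BigProduct *-commutativeMonoid
  open BigProduct mulP-commutativeMonoid

  +-abelianGroup : AbelianGroup _ _
  +-abelianGroup = record { isAbelianGroup = +-isAbelianGroup }

  open import Algebra.Properties.AbelianGroup +-abelianGroup
    using (⁻¹-∙-comm; ⁻¹-involutive; x∙y⁻¹≈ε⇒x≈y)

  -- Fermat's little theorem

  1≢0 : 1F ≢ 0F
  1≢0 e = 0≢1 (sym e)

  inv : ∀ d → d ≢ 0F → Fin q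
  inv d d≢0 = proj₁ (inverse d d≢0)

  inv-cancelˡ : ∀ d (d≢0 : d ≢ 0F) a → inv d d≢0 *F (d *F a) ≡ a
  inv-cancelˡ d d≢0 a = begin
    inv d d≢0 *F (d *F a)  ≡⟨ sym (*-assoc _ d a) ⟩
    (inv d d≢0 *F d) *F a  ≡⟨ cong (_*F a) (trans (*-comm _ d) (proj₂ (inverse d d≢0))) ⟩
    1F *F a                ≡⟨ *-identityˡ a ⟩
    a                      ∎
    where open ≡-Reasoning

  inv-cancelʳ : ∀ d (d≢0 : d ≢ 0F) a → d *F (inv d d≢0 *F a) ≡ a
  inv-cancelʳ d d≢0 a = begin
    d *F (inv d d≢0 *F a)  ≡⟨ sym (*-assoc d _ a) ⟩
    (d *F inv d d≢0) *F a  ≡⟨ cong (_*F a) (proj₂ (inverse d d≢0)) ⟩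
    1F *F a                ≡⟨ *-identityˡ a ⟩
    a                      ∎
    where open ≡-Reasoning

  *-nonzero : ∀ {x y} → x ≢ 0F → y ≢ 0F → x *F y ≢ 0F
  *-nonzero {x} {y} x≢0 y≢0 xy≡0 =
    y≢0 (trans (sym (inv-cancelˡ x x≢0 y)) (trans (cong (inv x x≢0 *F_) xy≡0) (zeroʳ _)))

  *-cancel-nonzero : ∀ {x p} → p ≢ 0F → x *F p ≡ p → x ≡ 1F
  *-cancel-nonzero {x} {p} p≢0 xp≡p = begin
    x                       ≡⟨ sym (*-identityʳ x) ⟩
    x *F 1F                 ≡⟨ cong (x *F_) (sym (proj₂ (inverse p p≢0))) ⟩
    x *F (p *F inv p p≢0)   ≡⟨ sym (*-assoc x p _) ⟩
    (x *F p) *F inv p p≢0   ≡⟨ cong (_*F inv p p≢0) xp≡p ⟩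
    p *F inv p p≢0          ≡⟨ proj₂ (inverse p p≢0) ⟩
    1F                      ∎
    where open ≡-Reasoning

  ∏-nonzero : ∀ {A : Set} (G : A → Fin q) → (∀ a → G a ≢ 0F) → (xs : List A) → 𝔽.∏ xs G ≢ 0F
  ∏-nonzero G G≢0 []       = 1≢0
  ∏-nonzero G G≢0 (x ∷ xs) = *-nonzero (G≢0 x) (∏-nonzero G G≢0 xs)

  scaling : ∀ d → d ≢ 0F → Permutation′ q
  scaling d d≢0 = permutation (d *F_) (inv d d≢0 *F_) (inv-cancelʳ d d≢0) (inv-cancelˡ d d≢0)

  reflection-involutive : ∀ c a → c +F (-F (c +F (-F a))) ≡ a
  reflection-involutive c a = begin
    c +F (-F (c +F (-F a)))       ≡⟨ cong (c +F_) (sym (⁻¹-∙-comm c (-F a))) ⟩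
    c +F ((-F c) +F (-F (-F a)))  ≡⟨ sym (+-assoc c (-F c) _) ⟩
    (c +F (-F c)) +F (-F (-F a))  ≡⟨ cong₂ _+F_ (-‿inverseʳ c) (⁻¹-involutive a) ⟩
    0F +F a                       ≡⟨ +-identityˡ a ⟩
    a                             ∎
    where open ≡-Reasoning

  reflection : Fin q → Permutation′ q
  reflection c = permutation (λ a → c +F (-F a)) (λ a → c +F (-F a))
                   (reflection-involutive c) (reflection-involutive c)

  -- Multiplication by a nonzero d permutes the nonzero elements, so d^(q-1) = 1;
  -- 0 is kept out of the product by replacing it with 1.
  fermat : ∀ d → 𝔽.∏ (allFin q) (λ _ → d) ≡ d
  fermat d with d ≟ 0F
  ... | yes refl = ∏-zero d
    where
      ∏-zero : ∀ {n} → Fin n → 𝔽.∏ (allFin n) (λ _ → 0F) ≡ 0F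
      ∏-zero {suc n} _ = trans (𝔽.∏-allFin-suc n _) (zeroˡ _)
  ... | no d≢0 = begin
      𝔽.∏ (allFin q) (λ _ → d)               ≡⟨ 𝔽.∏-cong (allFin q) (λ a → sym (H*E≡d a)) ⟩
      𝔽.∏ (allFin q) (λ a → H a *F E a)      ≡⟨ 𝔽.∏-distrib H E (allFin q) ⟩
      𝔽.∏ (allFin q) H *F 𝔽.∏ (allFin q) E  ≡⟨ cong₂ _*F_ ∏H≡1 (𝔽.∏-allFin-indicator 0F d) ⟩
      1F *F d                                ≡⟨ *-identityˡ d ⟩
      d                                      ∎
    where
      open ≡-Reasoning
      unit H E : Fin q → Fin q
      unit a = if does (a ≟ 0F) then 1F else a
      H    a = if does (a ≟ 0F) then 1F else d
      E    a = if does (a ≟ 0F) then d else 1F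

      unit≢0 : ∀ a → unit a ≢ 0F
      unit≢0 a with a ≟ 0F
      ... | yes _   = 1≢0
      ... | no  a≢0 = a≢0

      unit-scaling : ∀ a → unit (d *F a) ≡ H a *F unit a
      unit-scaling a with a ≟ 0F | (d *F a) ≟ 0F
      ... | yes _    | yes _    = sym (*-identityˡ 1F)
      ... | yes refl | no da≢0  = ⊥-elim (da≢0 (zeroʳ d))
      ... | no a≢0   | yes da≡0 = ⊥-elim (*-nonzero d≢0 a≢0 da≡0)
      ... | no _     | no _     = refl

      H*E≡d : ∀ a → H a *F E a ≡ d
      H*E≡d a with a ≟ 0F
      ... | yes _ = *-identityˡ d
      ... | no  _ = *-identityʳ d

      ∏H≡1 : 𝔽.∏ (allFin q) H ≡ 1F
      ∏H≡1 = *-cancel-nonzero (∏-nonzero unit unit≢0 (allFin q)) (begin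
        𝔽.∏ (allFin q) H *F 𝔽.∏ (allFin q) unit    ≡⟨ 𝔽.∏-distrib H unit (allFin q) ⟨
        𝔽.∏ (allFin q) (λ a → H a *F unit a)       ≡⟨ 𝔽.∏-cong (allFin q) unit-scaling ⟨
        𝔽.∏ (allFin q) (λ a → unit (d *F a))       ≡⟨ 𝔽.∏-allFin-permute (scaling d d≢0) unit ⟩
        𝔽.∏ (allFin q) unit                        ∎)

  -- Products over all polynomials of degree < n

  ∏-constant : ∀ {A : Set} (G : A → Fin q) (xs : List A) → ∏ xs (λ a → [ G a ]) ≈ [ 𝔽.∏ xs G ]
  ∏-constant G []       = ≈-refl
  ∏-constant G (x ∷ xs) = ≈-trans (mulP-congʳ [ G x ] (∏-constant G xs)) (∷-cong (+-identityʳ _) ≈-refl)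

  ∏deg< : ℕ → (Pol → Pol) → Pol
  ∏deg< n H = ∏ (allLists n) H

  allLists-length : ∀ n → All (λ g → length g ≡ n) (allLists n)
  allLists-length zero    = refl ∷ []
  allLists-length (suc n) = all-cons (allFin q)
    where
      all-cons : ∀ as → All (λ g → length g ≡ suc n) (concatMap (λ a → map (a ∷_) (allLists n)) as)
      all-cons []       = []
      all-cons (a ∷ as) = All.++⁺ (All.map⁺ (All.map (cong suc) (allLists-length n))) (all-cons as)

  ∏deg<-cong : ∀ n {G H} → (∀ {gs} → length gs ≡ n → G gs ≈ H gs) → ∏deg< n G ≈ ∏deg< n H
  ∏deg<-cong n e = ∏-cong-All (All.map e (allLists-length n))

  ∏deg<-cons : ∀ n H → ∏deg< (suc n) H ≈ ∏ (allFin q) (λ a → ∏deg< n (λ gs → H (a ∷ gs)))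
  ∏deg<-cons n H = ≈-trans (∏-concatMap H (λ a → map (a ∷_) (allLists n)) (allFin q))
    (∏-cong (allFin q) (λ a → ≈-reflexive (∏-map H (a ∷_) (allLists n))))

  ∏deg<-snoc : ∀ n H → ∏deg< (suc n) H ≈ ∏ (allFin q) (λ b → ∏deg< n (λ gs → H (gs ∷ʳ b)))
  ∏deg<-snoc zero    H = ∏deg<-cons zero H
  ∏deg<-snoc (suc n) H = begin
    ∏deg< (suc (suc n)) H
      ≈⟨ ∏deg<-cons (suc n) H ⟩
    ∏ (allFin q) (λ a → ∏deg< (suc n) (λ gs → H (a ∷ gs)))
      ≈⟨ ∏-cong (allFin q) (λ a → ∏deg<-snoc n (λ gs → H (a ∷ gs))) ⟩
    ∏ (allFin q) (λ a → ∏ (allFin q) (λ b → ∏deg< n (λ gs → H (a ∷ gs ∷ʳ b))))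
      ≈⟨ ∏-comm (λ a b → ∏deg< n (λ gs → H (a ∷ gs ∷ʳ b))) (allFin q) (allFin q) ⟩
    ∏ (allFin q) (λ b → ∏ (allFin q) (λ a → ∏deg< n (λ gs → H (a ∷ gs ∷ʳ b))))
      ≈⟨ ∏-cong (allFin q) (λ b → ∏deg<-cons n (λ gs → H (gs ∷ʳ b))) ⟨
    ∏ (allFin q) (λ b → ∏deg< (suc n) (λ gs → H (gs ∷ʳ b)))  ∎
    where open import Relation.Binary.Reasoning.Setoid (CommutativeMonoid.setoid mulP-commutativeMonoid)

  ∏deg<-translate : ∀ cs H → ∏deg< (length cs) (λ gs → H (subP cs gs)) ≈ ∏deg< (length cs) H
  ∏deg<-translate []       H = ≈-refl
  ∏deg<-translate (c ∷ cs) H =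
    ≈-trans (∏deg<-cons (length cs) (λ gs → H (subP (c ∷ cs) gs)))
      (≈-trans (∏-cong (allFin q) (λ a → ∏deg<-translate cs (λ v → H ((c +F (-F a)) ∷ v))))
        (≈-trans (∏-allFin-permute (reflection c) (λ a → ∏deg< (length cs) (λ gs → H (a ∷ gs))))
          (≈-sym (∏deg<-cons (length cs) H))))

  ∏deg<-scale : ∀ n d → d ≢ 0F → ∀ H → ∏deg< n (λ v → H (scale d v)) ≈ ∏deg< n H
  ∏deg<-scale zero    d d≢0 H = ≈-refl
  ∏deg<-scale (suc n) d d≢0 H =
    ≈-trans (∏deg<-cons n (λ v → H (scale d v)))
      (≈-trans (∏-cong (allFin q) (λ a → ∏deg<-scale n d d≢0 (λ v → H ((d *F a) ∷ v))))
        (≈-trans (∏-allFin-permute (scaling d d≢0) (λ a → ∏deg< n (λ gs → H (a ∷ gs))))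
          (≈-sym (∏deg<-cons n H))))

  ∏deg<-constant : ∀ n d → ∏deg< n (λ _ → [ d ]) ≈ [ d ]
  ∏deg<-constant zero    d = mulP-identityʳ [ d ]
  ∏deg<-constant (suc n) d = ≈-trans (∏deg<-cons n (λ _ → [ d ]))
    (≈-trans (∏-cong (allFin q) (λ a → ∏deg<-constant n d))
      (≈-trans (∏-constant (λ _ → d) (allFin q)) (≈-reflexive (cong [_] (fermat d)))))

  monicProduct : ℕ → Pol
  monicProduct n = ∏deg< n (λ v → v ∷ʳ 1F)

  mulP-constantˡ : ∀ d p → mulP [ d ] p ≈ scale d p
  mulP-constantˡ d p = ≈-trans (addP-cong ≈-refl [0]≈[]) (addP-identityʳ (scale d p))

  -- gs ↦ cs − gs and v ↦ d·v permute the polynomials of degree < n, and d^(q^n) = d.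
  ∏deg<-leading : ∀ cs d → d ≢ 0F →
                  ∏deg< (length cs) (λ gs → subP cs gs ∷ʳ d) ≈ mulP [ d ] (monicProduct (length cs))
  ∏deg<-leading cs d d≢0 = begin
    ∏deg< n (λ gs → subP cs gs ∷ʳ d)                   ≈⟨ ∏deg<-translate cs (_∷ʳ d) ⟩
    ∏deg< n (λ v → v ∷ʳ d)                             ≈⟨ ∏deg<-scale n d d≢0 (_∷ʳ d) ⟨
    ∏deg< n (λ v → scale d v ∷ʳ d)                     ≈⟨ ∏-cong (allLists n) scale-monic ⟩
    ∏deg< n (λ v → mulP [ d ] (v ∷ʳ 1F))               ≈⟨ ∏-distrib (λ _ → [ d ]) (_∷ʳ 1F) (allLists n) ⟩
    mulP (∏deg< n (λ _ → [ d ])) (monicProduct n)      ≈⟨ mulP-congˡ (monicProduct n) (∏deg<-constant n d) ⟩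
    mulP [ d ] (monicProduct n)                        ∎
    where
      open import Relation.Binary.Reasoning.Setoid (CommutativeMonoid.setoid mulP-commutativeMonoid)
      n : ℕ
      n = length cs
      scale-monic : ∀ v → (scale d v ∷ʳ d) ≈ mulP [ d ] (v ∷ʳ 1F)
      scale-monic v = ≈-sym (≈-trans (mulP-constantˡ d (v ∷ʳ 1F))
        (≈-reflexive (trans (map-++ (d *F_) v [ 1F ]) (cong (λ z → scale d v ∷ʳ z) (*-identityʳ d)))))

  -- The factorial recursion in the top coefficient

  δ-∷ʳ : ∀ gs b → δ (gs ∷ʳ b) ≡ δ gs + q ℕ.^ length gs * toℕ b
  δ-∷ʳ []       b =
    trans (cong (toℕ b +_) (ℕ.*-zeroʳ q)) (trans (ℕ.+-identityʳ _) (sym (ℕ.+-identityʳ _)))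
  δ-∷ʳ (a ∷ gs) b = begin
    toℕ a + q * δ (gs ∷ʳ b)                         ≡⟨ cong (λ x → toℕ a + q * x) (δ-∷ʳ gs b) ⟩
    toℕ a + q * (δ gs + Q * toℕ b)                  ≡⟨ cong (toℕ a +_) (ℕ.*-distribˡ-+ q (δ gs) _) ⟩
    toℕ a + (q * δ gs + q * (Q * toℕ b))            ≡⟨ cong (λ x → toℕ a + (q * δ gs + x)) (ℕ.*-assoc q Q _) ⟨
    toℕ a + (q * δ gs + q * Q * toℕ b)              ≡⟨ ℕ.+-assoc (toℕ a) _ _ ⟨
    toℕ a + q * δ gs + q * Q * toℕ b                ∎
    where
      open ≡-Reasoning
      Q : ℕ
      Q = q ℕ.^ length gs

  δ<q^length : ∀ gs → δ gs < q ℕ.^ length gs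
  δ<q^length []       = ℕ.s≤s ℕ.z≤n
  δ<q^length (a ∷ gs) = begin
    suc (toℕ a) + q * δ gs  ≤⟨ ℕ.+-monoˡ-≤ (q * δ gs) (Fin.toℕ<n a) ⟩
    q + q * δ gs            ≡⟨ ℕ.*-suc q (δ gs) ⟨
    q * suc (δ gs)          ≤⟨ ℕ.*-monoʳ-≤ q (δ<q^length gs) ⟩
    q * q ℕ.^ length gs     ∎
    where open ℕ.≤-Reasoning

  top-digit-< : ∀ {x y Q b c} → x < Q → b < c → x + Q * b < y + Q * c
  top-digit-< {x} {y} {Q} {b} {c} x<Q b<c = begin-strict
    x + Q * b  <⟨ ℕ.+-monoˡ-< (Q * b) x<Q ⟩
    Q + Q * b  ≡⟨ ℕ.*-suc Q b ⟨
    Q * suc b  ≤⟨ ℕ.*-monoʳ-≤ Q b<c ⟩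
    Q * c      ≤⟨ ℕ.m≤n+m (Q * c) y ⟩
    y + Q * c  ∎
    where open ℕ.≤-Reasoning

  δ-∷ʳ-aligned : ∀ (cs gs : Pol) b → length gs ≡ length cs →
                 δ (gs ∷ʳ b) ≡ δ gs + q ℕ.^ length cs * toℕ b
  δ-∷ʳ-aligned cs gs b e = trans (δ-∷ʳ gs b) (cong (λ m → δ gs + q ℕ.^ m * toℕ b) e)

  δ-∷ʳ-<-top : ∀ (cs gs : Pol) {b c} → length gs ≡ length cs →
               toℕ b < toℕ c → δ (gs ∷ʳ b) < δ (cs ∷ʳ c)
  δ-∷ʳ-<-top cs gs {b} {c} e b<c =
    subst₂ _<_ (sym (δ-∷ʳ-aligned cs gs b e)) (sym (δ-∷ʳ-aligned cs cs c refl))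
      (top-digit-< (subst (λ m → δ gs < q ℕ.^ m) e (δ<q^length gs)) b<c)

  δ-∷ʳ-<-same : ∀ (cs gs : Pol) c → length gs ≡ length cs →
                (δ (gs ∷ʳ c) < δ (cs ∷ʳ c)) ⇔ (δ gs < δ cs)
  δ-∷ʳ-<-same cs gs c e = mk⇔
    (λ lt → ℕ.+-cancelʳ-< top (δ gs) (δ cs) (subst₂ _<_ δgs δcs lt))
    (λ lt → subst₂ _<_ (sym δgs) (sym δcs) (ℕ.+-monoˡ-< top lt))
    where
      top : ℕ
      top = q ℕ.^ length cs * toℕ c
      δgs : δ (gs ∷ʳ c) ≡ δ gs + top
      δgs = δ-∷ʳ-aligned cs gs c e
      δcs : δ (cs ∷ʳ c) ≡ δ cs + top
      δcs = δ-∷ʳ-aligned cs cs c refl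

  subP-∷ʳ : ∀ (cs gs : Pol) c b → length cs ≡ length gs →
            subP (cs ∷ʳ c) (gs ∷ʳ b) ≡ subP cs gs ∷ʳ (c +F (-F b))
  subP-∷ʳ []       []       c b e = refl
  subP-∷ʳ (x ∷ cs) (g ∷ gs) c b e = cong ((x +F (-F g)) ∷_) (subP-∷ʳ cs gs c b (ℕ.suc-injective e))

  factor : Pol → Pol → Pol
  factor f g = if does (δ g <? δ f) then subP f g else oneP

  fact≈∏factor : ∀ f → fact f ≈ ∏deg< (length f) (factor f)
  fact≈∏factor f = ∏-filter (λ g → δ g <? δ f) (subP f) (allLists (length f))

  factor-∷ʳ-< : ∀ (cs gs : Pol) {b c} → length gs ≡ length cs → toℕ b < toℕ c →
                factor (cs ∷ʳ c) (gs ∷ʳ b) ≡ subP cs gs ∷ʳ (c +F (-F b))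
  factor-∷ʳ-< cs gs {b} {c} e b<c
    rewrite dec-true (δ (gs ∷ʳ b) <? δ (cs ∷ʳ c)) (δ-∷ʳ-<-top cs gs e b<c) = subP-∷ʳ cs gs c b (sym e)

  factor-∷ʳ-> : ∀ (cs gs : Pol) {b c} → length gs ≡ length cs → toℕ c < toℕ b →
                factor (cs ∷ʳ c) (gs ∷ʳ b) ≡ oneP
  factor-∷ʳ-> cs gs {b} {c} e c<b
    rewrite dec-false (δ (gs ∷ʳ b) <? δ (cs ∷ʳ c)) (ℕ.<⇒≯ (δ-∷ʳ-<-top gs cs (sym e) c<b)) = refl

  factor-∷ʳ-≡ : ∀ (cs gs : Pol) c → length gs ≡ length cs →
                factor (cs ∷ʳ c) (gs ∷ʳ c) ≈ factor cs gs
  factor-∷ʳ-≡ cs gs c e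
    rewrite does-⇔ (δ-∷ʳ-<-same cs gs c e) (δ (gs ∷ʳ c) <? δ (cs ∷ʳ c)) (δ gs <? δ cs)
    with does (δ gs <? δ cs)
  ... | true  = ≈-trans (≈-reflexive (trans (subP-∷ʳ cs gs c c (sym e)) (cong (subP cs gs ∷ʳ_) (-‿inverseʳ c))))
                        (∷ʳ0≈ (subP cs gs))
  ... | false = ≈-refl

  ∏deg<-top-coefficient : ∀ (cs : Pol) c b →
    ∏deg< (length cs) (λ gs → factor (cs ∷ʳ c) (gs ∷ʳ b))
      ≈ mulP (mulP (if does (toℕ b <? toℕ c) then [ c +F (-F b) ] else oneP)
                   (if does (toℕ b <? toℕ c) then monicProduct (length cs) else oneP))
             (if does (b ≟ c) then fact cs else oneP)
  ∏deg<-top-coefficient cs c b with ℕ.<-cmp (toℕ b) (toℕ c)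
  ... | tri< b<c _ _
    rewrite dec-true (toℕ b <? toℕ c) b<c | dec-false (b ≟ c) (λ { refl → ℕ.<-irrefl refl b<c }) =
      ≈-trans (∏deg<-cong (length cs) (λ e → ≈-reflexive (factor-∷ʳ-< cs _ e b<c)))
        (≈-trans (∏deg<-leading cs (c +F (-F b)) c-b≢0) (≈-sym (mulP-identityʳ _)))
    where
      c-b≢0 : c +F (-F b) ≢ 0F
      c-b≢0 e = ℕ.<-irrefl (cong toℕ (sym (x∙y⁻¹≈ε⇒x≈y c b e))) b<c
  ... | tri≈ _ b≡c _ with refl ← Fin.toℕ-injective b≡c
    rewrite dec-false (toℕ b <? toℕ b) (ℕ.<-irrefl refl) | dec-true (b ≟ b) refl =
      ≈-trans (∏deg<-cong (length cs) (factor-∷ʳ-≡ cs _ b))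
        (≈-sym (≈-trans (mulP-congˡ (fact cs) (mulP-identityˡ oneP))
                 (≈-trans (mulP-identityˡ (fact cs)) (fact≈∏factor cs))))
  ... | tri> _ _ c<b
    rewrite dec-false (toℕ b <? toℕ c) (ℕ.<⇒≯ c<b) | dec-false (b ≟ c) (λ { refl → ℕ.<-irrefl refl c<b }) =
      ≈-trans (∏deg<-cong (length cs) (λ e → ≈-reflexive (factor-∷ʳ-> cs _ e c<b)))
        (≈-trans (∏-ε (allLists (length cs))) (≈-sym (≈-trans (mulP-identityʳ _) (mulP-identityˡ oneP))))

  constantFactorial : Fin q → Pol
  constantFactorial c = ∏ (allFin q) (λ b → if does (toℕ b <? toℕ c) then [ c +F (-F b) ] else oneP)

  fact-∷ʳ : ∀ cs c →
            fact (cs ∷ʳ c) ≈ mulP (mulP (constantFactorial c) (monicProduct (length cs) ^ toℕ c)) (fact cs)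
  fact-∷ʳ cs c = begin
    fact (cs ∷ʳ c)
      ≈⟨ fact≈∏factor (cs ∷ʳ c) ⟩
    ∏deg< (length (cs ∷ʳ c)) (factor (cs ∷ʳ c))
      ≡⟨ cong (λ m → ∏deg< m (factor (cs ∷ʳ c))) (length-++-comm cs [ c ]) ⟩
    ∏deg< (suc n) (factor (cs ∷ʳ c))
      ≈⟨ ∏deg<-snoc n (factor (cs ∷ʳ c)) ⟩
    ∏ (allFin q) (λ b → ∏deg< n (λ gs → factor (cs ∷ʳ c) (gs ∷ʳ b)))
      ≈⟨ ∏-cong (allFin q) (∏deg<-top-coefficient cs c) ⟩
    ∏ (allFin q) (λ b → mulP (mulP (C b) (M b)) (E b))
      ≈⟨ ∏-distrib (λ b → mulP (C b) (M b)) E (allFin q) ⟩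
    mulP (∏ (allFin q) (λ b → mulP (C b) (M b))) (∏ (allFin q) E)
      ≈⟨ mulP-cong (∏-distrib C M (allFin q)) (∏-allFin-indicator c (fact cs)) ⟩
    mulP (mulP (constantFactorial c) (∏ (allFin q) M)) (fact cs)
      ≈⟨ mulP-congˡ (fact cs) (mulP-congʳ (constantFactorial c) (∏-allFin-below c (monicProduct n))) ⟩
    mulP (mulP (constantFactorial c) (monicProduct n ^ toℕ c)) (fact cs)  ∎
    where
      open import Relation.Binary.Reasoning.Setoid (CommutativeMonoid.setoid mulP-commutativeMonoid)
      n : ℕ
      n = length cs
      C M E : Fin q → Pol
      C b = if does (toℕ b <? toℕ c) then [ c +F (-F b) ] else oneP
      M b = if does (toℕ b <? toℕ c) then monicProduct n else oneP
      E b = if does (b ≟ c) then fact cs else oneP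

  powP≡^ : ∀ p k → powP p k ≡ p ^ k
  powP≡^ p zero    = refl
  powP≡^ p (suc k) = cong (mulP p) (powP≡^ p k)

  monicPow≈^ : ∀ n k → monicPow n k ≈ monicProduct n ^ k
  monicPow≈^ n k = ≈-trans (∏-cong (allLists n) (λ v → ≈-reflexive (powP≡^ (v ∷ʳ 1F) k)))
                           (∏-^ (_∷ʳ 1F) (allLists n) k)

  monicProduct-0^ : ∀ k → monicProduct 0 ^ k ≈ oneP
  monicProduct-0^ zero    = ≈-refl
  monicProduct-0^ (suc k) = ≈-trans (mulP-cong (mulP-identityʳ oneP) (monicProduct-0^ k)) (mulP-identityʳ oneP)

  fact-constant : ∀ c → fact [ c ] ≈ constantFactorial c
  fact-constant c = ≈-trans (fact-∷ʳ [] c) (≈-trans (mulP-identityʳ _)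
    (≈-trans (mulP-congʳ (constantFactorial c) (monicProduct-0^ (toℕ c))) (mulP-identityʳ _)))

  tailProd-∷ʳ : ∀ j xs c →
                tailProd j (xs ∷ʳ c) ≈ mulP (tailProd j xs) (monicPow (j + length xs) (toℕ c))
  tailProd-∷ʳ j []       c = ≈-trans (mulP-identityʳ _)
    (≈-trans (≈-reflexive (cong (λ m → monicPow m (toℕ c)) (sym (ℕ.+-identityʳ j))))
             (≈-sym (mulP-identityˡ _)))
  tailProd-∷ʳ j (a ∷ xs) c = begin
    mulP (monicPow j (toℕ a)) (tailProd (suc j) (xs ∷ʳ c))
      ≈⟨ mulP-congʳ (monicPow j (toℕ a)) (tailProd-∷ʳ (suc j) xs c) ⟩
    mulP (monicPow j (toℕ a)) (mulP (tailProd (suc j) xs) (monicPow (suc j + length xs) (toℕ c)))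
      ≈⟨ mulP-assoc (monicPow j (toℕ a)) (tailProd (suc j) xs) _ ⟨
    mulP (tailProd j (a ∷ xs)) (monicPow (suc j + length xs) (toℕ c))
      ≡⟨ cong (λ m → mulP (tailProd j (a ∷ xs)) (monicPow m (toℕ c))) (sym (ℕ.+-suc j (length xs))) ⟩
    mulP (tailProd j (a ∷ xs)) (monicPow (j + length (a ∷ xs)) (toℕ c))  ∎
    where open import Relation.Binary.Reasoning.Setoid (CommutativeMonoid.setoid mulP-commutativeMonoid)

  tailProd-drop : ∀ f → tailProd 1 (drop 1 f) ≈ tailProd 0 f
  tailProd-drop []       = ≈-refl
  tailProd-drop (a ∷ as) = ≈-sym (≈-trans (mulP-congˡ _ monicPow-0) (mulP-identityˡ _))
    where
      monicPow-0 : monicPow 0 (toℕ a) ≈ oneP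
      monicPow-0 = ≈-trans (monicPow≈^ 0 (toℕ a)) (monicProduct-0^ (toℕ a))

  ∏fact-constant : Pol → Pol
  ∏fact-constant f = prodP (map (λ a → fact (a ∷ [])) f)

  ∏fact-constant-∷ʳ : ∀ xs c → ∏fact-constant (xs ∷ʳ c) ≈ mulP (∏fact-constant xs) (fact [ c ])
  ∏fact-constant-∷ʳ xs c = ≈-trans (∏-++ (λ a → fact (a ∷ [])) xs [ c ])
                                   (mulP-congʳ (∏fact-constant xs) (mulP-identityʳ (fact [ c ])))

  fact≈∏fact-constant : ∀ {f} → Reverse f → fact f ≈ mulP (∏fact-constant f) (tailProd 0 f)
  fact≈∏fact-constant [] = ≈-sym (mulP-identityˡ oneP)
  fact≈∏fact-constant (cs ∶ r ∶ʳ c) = begin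
    fact (cs ∷ʳ c)
      ≈⟨ fact-∷ʳ cs c ⟩
    mulP (mulP (constantFactorial c) Mᶜ) (fact cs)
      ≈⟨ mulP-congʳ (mulP (constantFactorial c) Mᶜ) (fact≈∏fact-constant r) ⟩
    mulP (mulP (constantFactorial c) Mᶜ) (mulP A T)
      ≈⟨ interchange (constantFactorial c) Mᶜ A T ⟩
    mulP (mulP (constantFactorial c) A) (mulP Mᶜ T)
      ≈⟨ mulP-cong (≈-trans (mulP-comm _ A) (mulP-congʳ A (≈-sym (fact-constant c))))
                   (≈-trans (mulP-comm Mᶜ T) (mulP-congʳ T (≈-sym (monicPow≈^ (length cs) (toℕ c))))) ⟩
    mulP (mulP A (fact [ c ])) (mulP T (monicPow (length cs) (toℕ c)))
      ≈⟨ mulP-cong (≈-sym (∏fact-constant-∷ʳ cs c)) (≈-sym (tailProd-∷ʳ 0 cs c)) ⟩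
    mulP (∏fact-constant (cs ∷ʳ c)) (tailProd 0 (cs ∷ʳ c))  ∎
    where
      open import Relation.Binary.Reasoning.Setoid (CommutativeMonoid.setoid mulP-commutativeMonoid)
      open import Algebra.Properties.CommutativeSemigroup
        (CommutativeMonoid.commutativeSemigroup mulP-commutativeMonoid) using (interchange)
      Mᶜ A T : Pol
      Mᶜ = monicProduct (length cs) ^ toℕ c
      A  = ∏fact-constant cs
      T  = tailProd 0 cs

  fact≈rhs : ∀ f → fact f ≈ rhs f
  fact≈rhs f = ≈-trans (fact≈∏fact-constant (reverseView f))
                       (mulP-congʳ (∏fact-constant f) (≈-sym (tailProd-drop f)))

-- The hypothesis that the leading coefficient is nonzero is not needed:
-- trailing zeros change neither δ nor the normalized value of either side.
lemma2p1 : (q : ℕ) (F : FiniteField q) (cs : List (Fin q)) (c : Fin q) →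
           c ≢ FiniteField.0F F →
           Poly.normalize F (Poly.fact F (cs ++ c ∷ []))
             ≡ Poly.normalize F (Poly.rhs F (cs ++ c ∷ []))
lemma2p1 q F cs c _ = normalize-cong F (fact≈rhs F (cs ++ c ∷ []))
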